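{- Let $Q_6$ denote the $6$-dimensional hypercube graph, whose vertex set is $\{0,1\}^6$ and in which two vertices are adjacent if and only if they differ in exactly one coordinate. There exists a spanning subgraph $G$ of $Q_6$ (i.e. $G$ has the same vertex set $\{0,1\}^6$ and its edge set is a subset of the edge set of $Q_6$) such that $G$ has exactly $81$ edges and $G$ has diameter $6$ (in particular $G$ is connected). Consequently, the minimum number of edges of a spanning subgraph of $Q_6$ of diameter $6$ is strictly less than $2^6+\binom{6}{3}-2=82$.
   Context: The diameter of a connected graph is the maximum, over all pairs of vertices, of the length of a shortest path between them. The hypercube $Q_d$ itself has diameter $d$. -}

module Defs where

open import Data.Bool using (Bool; true; false; if_then_else_)
open import Data.Nat using (ℕ; zero; suc; _+_; _≤_; ⌊_/2⌋)
open import Data.Vec using (Vec; []; _∷_)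
open import Data.List using (List; []; _∷_; map; _++_)
open import Data.Nat.ListAction using (sum)
open import Data.Product using (Σ; ∃; ∃-syntax; _×_; _,_)
open import Relation.Binary.PropositionalEquality using (_≡_)

Vertex : ℕ → Set
Vertex d = Vec Bool d

hamming : ∀ {d} → Vertex d → Vertex d → ℕ
hamming [] [] = 0
hamming (true ∷ u) (true ∷ v) = hamming u v
hamming (false ∷ u) (false ∷ v) = hamming u v
hamming (true ∷ u) (false ∷ v) = suc (hamming u v)
hamming (false ∷ u) (true ∷ v) = suc (hamming u v)

QAdj : ∀ {d} → Vertex d → Vertex d → Set
QAdj u v = hamming u v ≡ 1

allVertices : (d : ℕ) → List (Vertex d)
allVertices zero = [] ∷ []
allVertices (suc d) = map (false ∷_) (allVertices d) ++ map (true ∷_) (allVertices d)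

record SpanningSubgraph (d : ℕ) : Set where
  field
    adj : Vertex d → Vertex d → Bool
    sym : ∀ u v → adj u v ≡ adj v u
    sub : ∀ u v → adj u v ≡ true → QAdj u v

orderedAdjCount : ∀ {d} → SpanningSubgraph d → ℕ
orderedAdjCount {d} G =
  sum (map (λ u → sum (map (λ v → if SpanningSubgraph.adj G u v then 1 else 0)
                           (allVertices d)))
           (allVertices d))

-- Number of edges (each unordered edge is counted twice as an ordered pair).
edgeCount : ∀ {d} → SpanningSubgraph d → ℕ
edgeCount G = ⌊ orderedAdjCount G /2⌋

data Walk {d : ℕ} (G : SpanningSubgraph d) : Vertex d → Vertex d → ℕ → Set where
  here : ∀ {u} → Walk G u u 0
  step : ∀ {u v w k} → SpanningSubgraph.adj G u v ≡ true → Walk G v w k → Walk G u w (suc k)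

HasDiameter : ∀ {d} → SpanningSubgraph d → ℕ → Set
HasDiameter {d} G D =
  (∀ (u v : Vertex d) → ∃[ k ] (k ≤ D × Walk G u v k))
  × (∃[ u ] ∃[ v ] (∀ k → Walk G u v k → D ≤ k))

{-# OPTIONS --safe #-}
module Submission where

-- Every edge of Q_d changes one coordinate, so a walk from u to v has length at
-- least the Hamming distance of u and v; hence antipodal vertices lie at distance
-- at least d in any spanning subgraph of Q_d. For an explicit 81-edge graph G₈₁
-- the matching upper bound is certified by computation: a depth-first search finds
-- a walk of length at most 6 between every pair of vertices.

open import Defs
open import Algebra.Properties.CommutativeSemigroup using (interchange)
open import Data.Bool using (Bool; true; false; not; _∧_; _xor_; if_then_else_; T)
open import Data.Bool.Properties using (T-≡; T-∧; ∧-comm) renaming (_≟_ to _≟ᵇ_)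
open import Data.Bool.ListAction using (all)
open import Data.List using (List; []; _∷_; map; _++_; foldr)
open import Data.List.Membership.Propositional using (_∈_)
open import Data.List.Membership.Propositional.Properties using (∈-map⁺; ∈-++⁺ˡ; ∈-++⁺ʳ)
open import Data.List.Relation.Unary.All using (lookup)
open import Data.List.Relation.Unary.All.Properties using (all⁺)
open import Data.List.Relation.Unary.Any using (here)
open import Data.Maybe using (Maybe; just; nothing; is-just; _<∣>_; to-witness-T)
import Data.Maybe as Maybe
open import Data.Nat using (ℕ; zero; suc; _<_; _+_; _∸_; _^_; _≤_; z≤n; s≤s; _≡ᵇ_; _≤ᵇ_)
open import Data.Nat.Combinatorics using (_C_)
open import Data.Nat.Properties
  using (≤-reflexive; +-mono-≤; +-commutativeSemigroup; ≡ᵇ⇒≡; n<1+n; module ≤-Reasoning)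
open import Data.Product using (∃-syntax; _×_; _,_; proj₁)
open import Data.Unit using (tt)
open import Data.Vec using (Vec; []; _∷_; replicate) renaming (map to mapᵥ)
open import Data.Vec.Properties using (≡-dec)
open import Function.Bundles using (Equivalence)
open import Relation.Binary.PropositionalEquality using (_≡_; refl; cong; cong₂; sym; subst)
open import Relation.Nullary using (yes; no)

hamming-self≡0 : ∀ {d} (u : Vertex d) → hamming u u ≡ 0
hamming-self≡0 []          = refl
hamming-self≡0 (false ∷ u) = hamming-self≡0 u
hamming-self≡0 (true ∷ u)  = hamming-self≡0 u

hamming-sym : ∀ {d} (u v : Vertex d) → hamming u v ≡ hamming v u
hamming-sym []          []          = refl
hamming-sym (false ∷ u) (false ∷ v) = hamming-sym u v
hamming-sym (false ∷ u) (true ∷ v)  = cong suc (hamming-sym u v)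
hamming-sym (true ∷ u)  (false ∷ v) = cong suc (hamming-sym u v)
hamming-sym (true ∷ u)  (true ∷ v)  = hamming-sym u v

hamming-∷ : ∀ {d} a b (u v : Vertex d) →
            hamming (a ∷ u) (b ∷ v) ≡ hamming (a ∷ []) (b ∷ []) + hamming u v
hamming-∷ false false u v = refl
hamming-∷ false true  u v = refl
hamming-∷ true  false u v = refl
hamming-∷ true  true  u v = refl

hamming-triangle-bit : ∀ a b c →
                       hamming (a ∷ []) (c ∷ []) ≤ hamming (a ∷ []) (b ∷ []) + hamming (b ∷ []) (c ∷ [])
hamming-triangle-bit false _     false = z≤n
hamming-triangle-bit true  _     true  = z≤n
hamming-triangle-bit false false true  = s≤s z≤n
hamming-triangle-bit false true  true  = s≤s z≤n
hamming-triangle-bit true  false false = s≤s z≤n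
hamming-triangle-bit true  true  false = s≤s z≤n

hamming-triangle : ∀ {d} (u w v : Vertex d) → hamming u v ≤ hamming u w + hamming w v
hamming-triangle []      []      []      = z≤n
hamming-triangle (a ∷ u) (b ∷ w) (c ∷ v) = begin
  hamming (a ∷ u) (c ∷ v)
    ≡⟨ hamming-∷ a c u v ⟩
  δ a c + hamming u v
    ≤⟨ +-mono-≤ (hamming-triangle-bit a b c) (hamming-triangle u w v) ⟩
  (δ a b + δ b c) + (hamming u w + hamming w v)
    ≡⟨ interchange +-commutativeSemigroup (δ a b) (δ b c) _ _ ⟩
  (δ a b + hamming u w) + (δ b c + hamming w v)
    ≡⟨ sym (cong₂ _+_ (hamming-∷ a b u w) (hamming-∷ b c w v)) ⟩
  hamming (a ∷ u) (b ∷ w) + hamming (b ∷ w) (c ∷ v) ∎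
  where
  open ≤-Reasoning
  δ : Bool → Bool → ℕ
  δ x y = hamming (x ∷ []) (y ∷ [])

antipode : ∀ {d} → Vertex d → Vertex d
antipode = mapᵥ not

hamming-antipode : ∀ {d} (u : Vertex d) → hamming u (antipode u) ≡ d
hamming-antipode []          = refl
hamming-antipode (false ∷ u) = cong suc (hamming-antipode u)
hamming-antipode (true ∷ u)  = cong suc (hamming-antipode u)

cubeNeighbours : ∀ {d} → Vertex d → List (Vertex d)
cubeNeighbours []      = []
cubeNeighbours (a ∷ u) = (not a ∷ u) ∷ map (a ∷_) (cubeNeighbours u)

∈-allVertices : ∀ {d} (v : Vertex d) → v ∈ allVertices d
∈-allVertices []          = here refl
∈-allVertices (false ∷ v) = ∈-++⁺ˡ (∈-map⁺ (false ∷_) (∈-allVertices v))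
∈-allVertices (true ∷ v)  =
  ∈-++⁺ʳ (map (false ∷_) (allVertices _)) (∈-map⁺ (true ∷_) (∈-allVertices v))

all-allVertices : ∀ {d} (p : Vertex d → Bool) → T (all p (allVertices d)) → ∀ v → T (p v)
all-allVertices {d} p h v = lookup (all⁺ p (allVertices d) h) (∈-allVertices v)

all-allVertices² : ∀ {d} (p : Vertex d → Vertex d → Bool) →
                   T (all (λ u → all (p u) (allVertices d)) (allVertices d)) → ∀ u v → T (p u v)
all-allVertices² p h u = all-allVertices (p u) (all-allVertices _ h u)

spanningSubgraph : ∀ {d} → (Vertex d → Vertex d → Bool) → SpanningSubgraph d
spanningSubgraph {d} R = record { adj = adj ; sym = adj-sym ; sub = adj-sub }
  where
  adj : Vertex d → Vertex d → Bool
  adj u v = (hamming u v ≡ᵇ 1) ∧ (R u v ∧ R v u)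

  adj-sym : ∀ u v → adj u v ≡ adj v u
  adj-sym u v rewrite hamming-sym u v | ∧-comm (R u v) (R v u) = refl

  adj-sub : ∀ u v → adj u v ≡ true → QAdj u v
  adj-sub u v uv = ≡ᵇ⇒≡ (hamming u v) 1 (proj₁ (Equivalence.to T-∧ (Equivalence.from T-≡ uv)))

module _ {d} (G : SpanningSubgraph d) where
  open SpanningSubgraph G using (adj; sub)

  hamming≤length : ∀ {u v k} → Walk G u v k → hamming u v ≤ k
  hamming≤length (here {u}) = ≤-reflexive (hamming-self≡0 u)
  hamming≤length (step {u} {w} {v} {k} uw p) = begin
    hamming u v               ≤⟨ hamming-triangle u w v ⟩
    hamming u w + hamming w v ≡⟨ cong (_+ hamming w v) (sub u w uw) ⟩
    suc (hamming w v)         ≤⟨ s≤s (hamming≤length p) ⟩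
    suc k                     ∎
    where open ≤-Reasoning

  walk-to-antipode⇒d≤length : ∀ u k → Walk G u (antipode u) k → d ≤ k
  walk-to-antipode⇒d≤length u k p = subst (_≤ k) (hamming-antipode u) (hamming≤length p)

  WalkWithin : ℕ → Vertex d → Vertex d → Set
  WalkWithin n u v = ∃[ k ] (k ≤ n × Walk G u v k)

  findWalkWithin : ∀ n u v → Maybe (WalkWithin n u v)
  findWalkWithin n u v with ≡-dec _≟ᵇ_ u v
  ... | yes refl = just (0 , z≤n , here)
  findWalkWithin zero    u v | no _ = nothing
  findWalkWithin (suc n) u v | no _ = foldr _<∣>_ nothing (map via (cubeNeighbours u))
    where
    -- The test hamming w v ≤ n only prunes the search: by hamming≤length it
    -- discards no neighbour w from which v is reachable in n steps.
    via : Vertex d → Maybe (WalkWithin (suc n) u v)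
    via w with hamming w v ≤ᵇ n | adj u w in uw
    ... | true | true =
      Maybe.map (λ (k , k≤n , p) → suc k , s≤s k≤n , step uw p) (findWalkWithin n w v)
    ... | _    | _    = nothing

portTowards : ∀ {d} → Vec Bool d → Vertex d → Vertex d → Bool
portTowards []       []      []      = false
portTowards (p ∷ ps) (a ∷ u) (b ∷ v) = if a xor b then p else portTowards ps u v

pattern O = false
pattern I = true

-- ports u lists the directions i for which G₈₁ contains the edge from u to the
-- vertex obtained by flipping coordinate i of u.
ports : Vertex 6 → Vec Bool 6
ports (O ∷ O ∷ O ∷ O ∷ O ∷ O ∷ []) = O ∷ I ∷ I ∷ I ∷ O ∷ O ∷ []
ports (O ∷ O ∷ O ∷ O ∷ O ∷ I ∷ []) = O ∷ I ∷ O ∷ I ∷ O ∷ O ∷ []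
ports (O ∷ O ∷ O ∷ O ∷ I ∷ O ∷ []) = O ∷ I ∷ O ∷ I ∷ O ∷ O ∷ []
ports (O ∷ O ∷ O ∷ O ∷ I ∷ I ∷ []) = O ∷ I ∷ O ∷ I ∷ O ∷ O ∷ []
ports (O ∷ O ∷ O ∷ I ∷ O ∷ O ∷ []) = O ∷ O ∷ I ∷ I ∷ O ∷ O ∷ []
ports (O ∷ O ∷ O ∷ I ∷ O ∷ I ∷ []) = O ∷ O ∷ I ∷ I ∷ O ∷ O ∷ []
ports (O ∷ O ∷ O ∷ I ∷ I ∷ O ∷ []) = O ∷ O ∷ I ∷ I ∷ O ∷ O ∷ []
ports (O ∷ O ∷ O ∷ I ∷ I ∷ I ∷ []) = I ∷ O ∷ O ∷ I ∷ O ∷ O ∷ []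
ports (O ∷ O ∷ I ∷ O ∷ O ∷ O ∷ []) = I ∷ O ∷ I ∷ O ∷ O ∷ O ∷ []
ports (O ∷ O ∷ I ∷ O ∷ O ∷ I ∷ []) = I ∷ I ∷ O ∷ O ∷ O ∷ O ∷ []
ports (O ∷ O ∷ I ∷ O ∷ I ∷ O ∷ []) = I ∷ I ∷ O ∷ O ∷ O ∷ O ∷ []
ports (O ∷ O ∷ I ∷ O ∷ I ∷ I ∷ []) = O ∷ I ∷ O ∷ I ∷ O ∷ O ∷ []
ports (O ∷ O ∷ I ∷ I ∷ O ∷ O ∷ []) = I ∷ O ∷ I ∷ O ∷ O ∷ O ∷ []
ports (O ∷ O ∷ I ∷ I ∷ O ∷ I ∷ []) = I ∷ O ∷ I ∷ O ∷ O ∷ O ∷ []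
ports (O ∷ O ∷ I ∷ I ∷ I ∷ O ∷ []) = I ∷ O ∷ I ∷ O ∷ O ∷ O ∷ []
ports (O ∷ O ∷ I ∷ I ∷ I ∷ I ∷ []) = I ∷ I ∷ O ∷ I ∷ O ∷ O ∷ []
ports (O ∷ I ∷ O ∷ O ∷ O ∷ O ∷ []) = I ∷ I ∷ I ∷ I ∷ I ∷ I ∷ []
ports (O ∷ I ∷ O ∷ O ∷ O ∷ I ∷ []) = O ∷ I ∷ O ∷ I ∷ O ∷ I ∷ []
ports (O ∷ I ∷ O ∷ O ∷ I ∷ O ∷ []) = I ∷ I ∷ I ∷ I ∷ I ∷ I ∷ []
ports (O ∷ I ∷ O ∷ O ∷ I ∷ I ∷ []) = O ∷ I ∷ I ∷ I ∷ O ∷ I ∷ []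
ports (O ∷ I ∷ O ∷ I ∷ O ∷ O ∷ []) = O ∷ O ∷ I ∷ I ∷ O ∷ O ∷ []
ports (O ∷ I ∷ O ∷ I ∷ O ∷ I ∷ []) = I ∷ O ∷ O ∷ I ∷ O ∷ O ∷ []
ports (O ∷ I ∷ O ∷ I ∷ I ∷ O ∷ []) = O ∷ O ∷ I ∷ I ∷ O ∷ O ∷ []
ports (O ∷ I ∷ O ∷ I ∷ I ∷ I ∷ []) = I ∷ O ∷ O ∷ I ∷ O ∷ O ∷ []
ports (O ∷ I ∷ I ∷ O ∷ O ∷ O ∷ []) = O ∷ O ∷ I ∷ O ∷ O ∷ I ∷ []
ports (O ∷ I ∷ I ∷ O ∷ O ∷ I ∷ []) = O ∷ I ∷ O ∷ O ∷ O ∷ I ∷ []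
ports (O ∷ I ∷ I ∷ O ∷ I ∷ O ∷ []) = O ∷ I ∷ I ∷ O ∷ O ∷ O ∷ []
ports (O ∷ I ∷ I ∷ O ∷ I ∷ I ∷ []) = O ∷ I ∷ I ∷ O ∷ O ∷ O ∷ []
ports (O ∷ I ∷ I ∷ I ∷ O ∷ O ∷ []) = O ∷ O ∷ I ∷ O ∷ O ∷ I ∷ []
ports (O ∷ I ∷ I ∷ I ∷ O ∷ I ∷ []) = I ∷ O ∷ O ∷ O ∷ O ∷ I ∷ []
ports (O ∷ I ∷ I ∷ I ∷ I ∷ O ∷ []) = O ∷ O ∷ I ∷ O ∷ O ∷ I ∷ []
ports (O ∷ I ∷ I ∷ I ∷ I ∷ I ∷ []) = O ∷ I ∷ O ∷ O ∷ O ∷ I ∷ []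
ports (I ∷ O ∷ O ∷ O ∷ O ∷ O ∷ []) = O ∷ I ∷ O ∷ O ∷ I ∷ O ∷ []
ports (I ∷ O ∷ O ∷ O ∷ O ∷ I ∷ []) = O ∷ I ∷ O ∷ I ∷ O ∷ O ∷ []
ports (I ∷ O ∷ O ∷ O ∷ I ∷ O ∷ []) = O ∷ O ∷ O ∷ O ∷ I ∷ I ∷ []
ports (I ∷ O ∷ O ∷ O ∷ I ∷ I ∷ []) = O ∷ O ∷ I ∷ O ∷ O ∷ I ∷ []
ports (I ∷ O ∷ O ∷ I ∷ O ∷ O ∷ []) = O ∷ I ∷ I ∷ O ∷ O ∷ O ∷ []
ports (I ∷ O ∷ O ∷ I ∷ O ∷ I ∷ []) = O ∷ I ∷ I ∷ I ∷ O ∷ O ∷ []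
ports (I ∷ O ∷ O ∷ I ∷ I ∷ O ∷ []) = O ∷ I ∷ I ∷ O ∷ O ∷ O ∷ []
ports (I ∷ O ∷ O ∷ I ∷ I ∷ I ∷ []) = I ∷ O ∷ I ∷ O ∷ O ∷ O ∷ []
ports (I ∷ O ∷ I ∷ O ∷ O ∷ O ∷ []) = I ∷ O ∷ O ∷ O ∷ O ∷ I ∷ []
ports (I ∷ O ∷ I ∷ O ∷ O ∷ I ∷ []) = I ∷ O ∷ O ∷ I ∷ O ∷ I ∷ []
ports (I ∷ O ∷ I ∷ O ∷ I ∷ O ∷ []) = I ∷ O ∷ O ∷ O ∷ O ∷ I ∷ []
ports (I ∷ O ∷ I ∷ O ∷ I ∷ I ∷ []) = O ∷ O ∷ I ∷ I ∷ O ∷ I ∷ []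
ports (I ∷ O ∷ I ∷ I ∷ O ∷ O ∷ []) = I ∷ O ∷ I ∷ O ∷ O ∷ I ∷ []
ports (I ∷ O ∷ I ∷ I ∷ O ∷ I ∷ []) = I ∷ I ∷ I ∷ I ∷ I ∷ I ∷ []
ports (I ∷ O ∷ I ∷ I ∷ I ∷ O ∷ []) = I ∷ I ∷ I ∷ O ∷ O ∷ I ∷ []
ports (I ∷ O ∷ I ∷ I ∷ I ∷ I ∷ []) = I ∷ I ∷ I ∷ I ∷ I ∷ I ∷ []
ports (I ∷ I ∷ O ∷ O ∷ O ∷ O ∷ []) = I ∷ I ∷ I ∷ I ∷ I ∷ O ∷ []
ports (I ∷ I ∷ O ∷ O ∷ O ∷ I ∷ []) = O ∷ I ∷ O ∷ O ∷ I ∷ O ∷ []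
ports (I ∷ I ∷ O ∷ O ∷ I ∷ O ∷ []) = I ∷ O ∷ I ∷ O ∷ I ∷ I ∷ []
ports (I ∷ I ∷ O ∷ O ∷ I ∷ I ∷ []) = O ∷ O ∷ O ∷ O ∷ I ∷ I ∷ []
ports (I ∷ I ∷ O ∷ I ∷ O ∷ O ∷ []) = O ∷ I ∷ O ∷ I ∷ I ∷ O ∷ []
ports (I ∷ I ∷ O ∷ I ∷ O ∷ I ∷ []) = I ∷ I ∷ O ∷ O ∷ O ∷ O ∷ []
ports (I ∷ I ∷ O ∷ I ∷ I ∷ O ∷ []) = O ∷ I ∷ O ∷ O ∷ I ∷ O ∷ []
ports (I ∷ I ∷ O ∷ I ∷ I ∷ I ∷ []) = I ∷ O ∷ I ∷ O ∷ O ∷ O ∷ []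
ports (I ∷ I ∷ I ∷ O ∷ O ∷ O ∷ []) = O ∷ O ∷ I ∷ I ∷ O ∷ O ∷ []
ports (I ∷ I ∷ I ∷ O ∷ O ∷ I ∷ []) = O ∷ O ∷ O ∷ I ∷ I ∷ O ∷ []
ports (I ∷ I ∷ I ∷ O ∷ I ∷ O ∷ []) = O ∷ O ∷ I ∷ O ∷ O ∷ I ∷ []
ports (I ∷ I ∷ I ∷ O ∷ I ∷ I ∷ []) = O ∷ O ∷ O ∷ O ∷ I ∷ I ∷ []
ports (I ∷ I ∷ I ∷ I ∷ O ∷ O ∷ []) = O ∷ O ∷ O ∷ I ∷ I ∷ O ∷ []
ports (I ∷ I ∷ I ∷ I ∷ O ∷ I ∷ []) = I ∷ I ∷ O ∷ I ∷ O ∷ O ∷ []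
ports (I ∷ I ∷ I ∷ I ∷ I ∷ O ∷ []) = O ∷ I ∷ O ∷ O ∷ I ∷ O ∷ []
ports (I ∷ I ∷ I ∷ I ∷ I ∷ I ∷ []) = O ∷ I ∷ I ∷ O ∷ O ∷ O ∷ []

G₈₁ : SpanningSubgraph 6
G₈₁ = spanningSubgraph (λ u v → portTowards (ports u) u v)

G₈₁-walksWithin6 : ∀ u v → WalkWithin G₈₁ 6 u v
G₈₁-walksWithin6 u v = to-witness-T (findWalkWithin G₈₁ 6 u v)
  (all-allVertices² (λ u v → is-just (findWalkWithin G₈₁ 6 u v)) tt u v)

mainTheorem1 : ∃[ G ] ((edgeCount {6} G ≡ 81) × HasDiameter G 6) × (81 < 2 ^ 6 + 6 C 3 ∸ 2)
mainTheorem1 =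
  G₈₁ , (refl , G₈₁-walksWithin6 , origin , antipode origin , walk-to-antipode⇒d≤length G₈₁ origin) , n<1+n 81
  where
  origin : Vertex 6
  origin = replicate 6 false
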